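{- Let $n$ be a positive integer that is a multiple of $3$ or a multiple of $4$. Then it is impossible to place $n-1$ queens on $\mathbb{Z}_n^2$ with no two in conflict.
   Context: Queens on the toroidal board $\mathbb{Z}_n^2$ occupy distinct fields; two queens at $(x,y)$ and $(x',y')$ are in conflict iff $x=x'$, or $y=y'$, or $x+y=x'+y'$, or $x-y=x'-y'$ in $\mathbb{Z}_n$. -}

module Defs where

open import Data.Nat using (ℕ; suc; _+_; _∸_; _%_; NonZero)
open import Data.Fin using (Fin; toℕ)
open import Data.Product using (_×_; _,_)
open import Data.Sum using (_⊎_)
open import Relation.Binary.PropositionalEquality using (_≡_)
open import Relation.Nullary using (¬_)

Field : ℕ → Set
Field n = Fin n × Fin n

SameSum : (n : ℕ) .{{_ : NonZero n}} → Field n → Field n → Set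
SameSum n (x , y) (x' , y') = (toℕ x + toℕ y) % n ≡ (toℕ x' + toℕ y') % n

-- Equality in Z_n of the differences x-y and x'-y'; since y < n,
-- x - y ≡ x + (n - y) (mod n), computed in ℕ without truncation.
SameDiff : (n : ℕ) .{{_ : NonZero n}} → Field n → Field n → Set
SameDiff n (x , y) (x' , y') =
  (toℕ x + (n ∸ toℕ y)) % n ≡ (toℕ x' + (n ∸ toℕ y')) % n

Conflict : (n : ℕ) .{{_ : NonZero n}} → Field n → Field n → Set
Conflict n (x , y) (x' , y') =
  x ≡ x' ⊎ y ≡ y' ⊎ SameSum n (x , y) (x' , y') ⊎ SameDiff n (x , y) (x' , y')

record NonAttacking (n : ℕ) .{{_ : NonZero n}} (m : ℕ) : Set where
  field
    queen    : Fin m → Field n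
    distinct : ∀ i j → ¬ i ≡ j → ¬ queen i ≡ queen j
    noConf   : ∀ i j → ¬ i ≡ j → ¬ Conflict n (queen i) (queen j)

-- Each of the four maps "column", "row", "diagonal x + y" and "antidiagonal x − y" sends the
-- n − 1 queens injectively into Z_n, so each misses exactly one value, say a, b, c, d.  Summing
-- the coordinates over the queens gives c ≡ a + b − T and d ≡ T + a − b (mod n), where
-- T = 0 + 1 + ⋯ + (n − 1).  Summing squares, s² + t² ≡ 2x² + 2y² holds modulo every N dividing
-- both 2n and n², and yields 2Q ≡ 2T(2b − T) (mod N) with Q = 0² + 1² + ⋯ + (n − 1)².  Since
-- 2T = n(n − 1), taking N = n gives n ∣ 2Q = n(n − 1)(2n − 1)/3, impossible when 3 ∣ n.  When
-- 4 ∣ n, T is even, and N = 2n gives 2n ∣ 2Q, so (n − 1)(2n − 1) would be even.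
module Submission where

open import Defs
open import Data.Nat using (ℕ; suc; _∸_)
open import Data.Nat.Divisibility using (_∣_)
open import Data.Sum using (_⊎_)
open import Relation.Nullary using (¬_)

open import Algebra.Bundles using (CommutativeMonoid)
import Data.Nat as ℕ
import Data.Nat.Divisibility as ℕ
open import Data.Nat.DivMod using (_%_; _/_; m≡m%n+[m/n]*n; m%n<n)
open import Data.Fin using (Fin; zero; suc; toℕ; fromℕ<; punchIn; punchOut)
open import Data.Fin.Properties
  using (_≟_; suc-injective; punchIn-punchOut; punchOut-injective; toℕ-inject₁; toℕ-fromℕ;
         toℕ-fromℕ<; toℕ≤n; fromℕ<-injective)
open import Data.Integer using (ℤ; +_; -_; _+_; _-_; _*_)
open import Data.Integer.Properties
  using (+-0-commutativeMonoid; +-*-semiring; *-distribˡ-+; pos-+; pos-*; ⊖-≥; m-n≡m⊖n;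
         *-identityʳ; *-comm; *-cancelˡ-≡)
open import Data.Integer.Divisibility.Signed
  using (divides; ∣ᵤ⇒∣; ∣⇒∣ᵤ; ∣-refl; ∣-trans; ∣m⇒∣-m; ∣m∣n⇒∣m+n; ∣m∣n⇒∣m-n; ∣m⇒∣m*n; ∣n⇒∣m*n;
         *-cancelˡ-∣; *-monoʳ-∣)
  renaming (_∣_ to _∣ℤ_)
open import Data.Integer.Tactic.RingSolver using (solve-∀)
open import Data.Product using (∃-syntax; _,_; proj₁; proj₂)
open import Data.Sum using (inj₁; inj₂)
open import Data.Empty using (⊥-elim)
open import Function using (_∘_)
open import Function.Definitions using (Injective)
open import Relation.Binary.PropositionalEquality
  using (_≡_; _≢_; refl; sym; trans; cong; cong₂; subst; subst₂; module ≡-Reasoning)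
open import Relation.Nullary using (yes; no; contradiction)

module _ {c ℓ} (M : CommutativeMonoid c ℓ) where
  open CommutativeMonoid M
    using (_≈_; _∙_; ∙-congˡ; setoid; commutativeSemigroup) renaming (refl to ≈-refl)
  open import Algebra.Properties.CommutativeMonoid.Sum M using (sum; sum-remove; sum-cong-≗)
  open import Algebra.Properties.CommutativeSemigroup commutativeSemigroup using (x∙yz≈y∙xz)
  open import Relation.Binary.Reasoning.Setoid setoid

  -- Delete the value h 0 from the codomain (punchOut) and recurse on the remaining injection.
  sum-missing-value : ∀ {k} (h : Fin k → Fin (suc k)) → Injective _≡_ _≡_ h →
                      ∃[ a ] ∀ f → sum f ≈ f a ∙ sum (f ∘ h)
  sum-missing-value {ℕ.zero} h h-inj = zero , λ f → ≈-refl
  sum-missing-value {suc k}  h h-inj = punchIn p a , λ f → begin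
    sum f                                               ≈⟨ sum-remove {i = p} f ⟩
    f p ∙ sum (f ∘ punchIn p)                           ≈⟨ ∙-congˡ (missing (f ∘ punchIn p)) ⟩
    f p ∙ (f (punchIn p a) ∙ sum (f ∘ punchIn p ∘ h′))  ≡⟨ cong (λ s → f p ∙ (f (punchIn p a) ∙ s))
                                                             (sum-cong-≗ (cong f ∘ punchIn-punchOut ∘ p≢h)) ⟩
    f p ∙ (f (punchIn p a) ∙ sum (f ∘ h ∘ suc))         ≈⟨ x∙yz≈y∙xz _ _ _ ⟩
    f (punchIn p a) ∙ sum (f ∘ h)                       ∎
    where
    p : Fin (suc (suc k))
    p = h zero
    p≢h : ∀ i → p ≢ h (suc i)
    p≢h i eq with h-inj eq
    ... | ()
    h′ : Fin k → Fin (suc k)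
    h′ i = punchOut (p≢h i)
    h′-inj : Injective _≡_ _≡_ h′
    h′-inj eq = suc-injective (h-inj (punchOut-injective (p≢h _) (p≢h _) eq))
    a : Fin (suc k)
    a = proj₁ (sum-missing-value h′ h′-inj)
    missing : ∀ g → sum g ≈ g a ∙ sum (g ∘ h′)
    missing = proj₂ (sum-missing-value h′ h′-inj)

open import Algebra.Properties.Semiring.Sum +-*-semiring
  using (sum; sum-syntax; sum-cong-≗; sum-init-last; ∑-distrib-+; *-distribˡ-sum)

sum∘injection : ∀ {k} (h : Fin k → Fin (suc k)) → Injective _≡_ _≡_ h →
                ∃[ a ] ∀ (f : Fin (suc k) → ℤ) → sum (f ∘ h) ≡ sum f - f a
sum∘injection h h-inj with sum-missing-value +-0-commutativeMonoid h h-inj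
... | a , missing = a , λ f → sym (trans (cong (_- f a) (missing f)) (cancel (f a) (sum (f ∘ h))))
  where
  cancel : ∀ x y → x + y - x ≡ y
  cancel = solve-∀

toℤ : ∀ {n} → Fin n → ℤ
toℤ r = + toℕ r

sum-toℕ-last : ∀ m (f : ℕ → ℤ) → ∑[ r < suc m ] f (toℕ r) ≡ ∑[ r < m ] f (toℕ r) + f m
sum-toℕ-last m f = trans (sum-init-last {m} (f ∘ toℕ))
  (cong₂ _+_ (sum-cong-≗ {m} (cong f ∘ toℕ-inject₁)) (cong f (toℕ-fromℕ m)))

triangular squarePyramidal : ℕ → ℤ
triangular m = ∑[ r < m ] toℤ r
squarePyramidal m = ∑[ r < m ] (toℤ r * toℤ r)

2*triangular : ∀ m → + 2 * triangular m ≡ + m * (+ m - + 1)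
2*triangular ℕ.zero  = refl
2*triangular (suc m) = begin
  + 2 * triangular (suc m)         ≡⟨ cong (+ 2 *_) (sum-toℕ-last m (λ j → + j)) ⟩
  + 2 * (triangular m + + m)       ≡⟨ *-distribˡ-+ (+ 2) (triangular m) (+ m) ⟩
  + 2 * triangular m + + 2 * + m   ≡⟨ cong (_+ + 2 * + m) (2*triangular m) ⟩
  + m * (+ m - + 1) + + 2 * + m    ≡⟨ step (+ m) ⟩
  (+ 1 + + m) * (+ 1 + + m - + 1)  ∎
  where
  open ≡-Reasoning
  step : ∀ x → x * (x - + 1) + + 2 * x ≡ (+ 1 + x) * (+ 1 + x - + 1)
  step = solve-∀

6*squarePyramidal : ∀ m → + 6 * squarePyramidal m ≡ + m * (+ m - + 1) * (+ 2 * + m - + 1)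
6*squarePyramidal ℕ.zero  = refl
6*squarePyramidal (suc m) = begin
  + 6 * squarePyramidal (suc m)                               ≡⟨ cong (+ 6 *_) (sum-toℕ-last m (λ j → + j * + j)) ⟩
  + 6 * (squarePyramidal m + + m * + m)                       ≡⟨ *-distribˡ-+ (+ 6) (squarePyramidal m) _ ⟩
  + 6 * squarePyramidal m + + 6 * (+ m * + m)                 ≡⟨ cong (_+ + 6 * (+ m * + m)) (6*squarePyramidal m) ⟩
  + m * (+ m - + 1) * (+ 2 * + m - + 1) + + 6 * (+ m * + m)   ≡⟨ step (+ m) ⟩
  (+ 1 + + m) * (+ 1 + + m - + 1) * (+ 2 * (+ 1 + + m) - + 1) ∎
  where
  open ≡-Reasoning
  step : ∀ x → x * (x - + 1) * (+ 2 * x - + 1) + + 6 * (x * x)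
               ≡ (+ 1 + x) * (+ 1 + x - + 1) * (+ 2 * (+ 1 + x) - + 1)
  step = solve-∀

∣2*squarePyramidal⇒∣[m-1][2m-1] : ∀ m c .{{_ : ℕ.NonZero m}} → + m * c ∣ℤ + 2 * squarePyramidal m →
                                  + 3 * c ∣ℤ (+ m - + 1) * (+ 2 * + m - + 1)
∣2*squarePyramidal⇒∣[m-1][2m-1] m c mc∣2Q = *-cancelˡ-∣ (+ m)
  (subst₂ _∣ℤ_ (reorder (+ m) c)
    (trans (triple (squarePyramidal m)) (trans (6*squarePyramidal m) (reassoc (+ m))))
    (*-monoʳ-∣ (+ 3) mc∣2Q))
  where
  reorder : ∀ m c → + 3 * (m * c) ≡ m * (+ 3 * c)
  reorder = solve-∀
  triple : ∀ Q → + 3 * (+ 2 * Q) ≡ + 6 * Q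
  triple = solve-∀
  reassoc : ∀ m → m * (m - + 1) * (+ 2 * m - + 1) ≡ m * ((m - + 1) * (+ 2 * m - + 1))
  reassoc = solve-∀

∣m∧∣[m-1][2m-1]⇒∣1 : ∀ {p m} → p ∣ℤ m → p ∣ℤ (m - + 1) * (+ 2 * m - + 1) → p ∣ℤ + 1
∣m∧∣[m-1][2m-1]⇒∣1 {p} {m} p∣m p∣R =
  subst (p ∣ℤ_) (expand m) (∣m∣n⇒∣m-n p∣R (∣m⇒∣m*n (+ 2 * m - + 3) p∣m))
  where
  expand : ∀ m → (m - + 1) * (+ 2 * m - + 1) - m * (+ 2 * m - + 3) ≡ + 1
  expand = solve-∀

+∣1⇒≡1 : ∀ {p} → + p ∣ℤ + 1 → p ≡ 1
+∣1⇒≡1 p∣1 = ℕ.∣1⇒≡1 (∣⇒∣ᵤ p∣1)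

infix 4 _≡_mod_
_≡_mod_ : ℤ → ℤ → ℤ → Set
a ≡ b mod N = N ∣ℤ a - b

∣-resp-≡mod : ∀ {a b N} → a ≡ b mod N → N ∣ℤ b → N ∣ℤ a
∣-resp-≡mod {a} {b} a≡b N∣b = subst (_ ∣ℤ_) (cancel a b) (∣m∣n⇒∣m+n a≡b N∣b)
  where
  cancel : ∀ a b → a - b + b ≡ a
  cancel = solve-∀

%-≡mod : ∀ m d .{{_ : ℕ.NonZero d}} → + (m % d) ≡ + m mod + d
%-≡mod m d = divides (- + (m / d)) (begin
  + (m % d) - + m                             ≡⟨ cong (λ z → + (m % d) - + z) (m≡m%n+[m/n]*n m d) ⟩
  + (m % d) - + (m % d ℕ.+ m / d ℕ.* d)       ≡⟨ cong (λ z → + (m % d) - z) (trans (pos-+ (m % d) _)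
                                                   (cong (λ z → + (m % d) + z) (pos-* (m / d) d))) ⟩
  + (m % d) - (+ (m % d) + + (m / d) * + d)   ≡⟨ cancel (+ (m % d)) (+ (m / d)) (+ d) ⟩
  - + (m / d) * + d                           ∎)
  where
  open ≡-Reasoning
  cancel : ∀ r q d → r - (r + q * d) ≡ - q * d
  cancel = solve-∀

sum-≡mod : ∀ {m N} {f g : Fin m → ℤ} → (∀ i → f i ≡ g i mod N) → sum f ≡ sum g mod N
sum-≡mod {ℕ.zero}           f≡g = divides (+ 0) refl
sum-≡mod {suc m} {f = f} {g} f≡g =
  subst (_ ∣ℤ_) (regroup (f zero) (g zero) (sum (f ∘ suc)) (sum (g ∘ suc)))
    (∣m∣n⇒∣m+n (f≡g zero) (sum-≡mod (f≡g ∘ suc)))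
  where
  regroup : ∀ x y s t → x - y + (s - t) ≡ x + s - (y + t)
  regroup = solve-∀

-- If a = b + n u then a² − b² = 2n·ub + n²·u².
square-≡mod : ∀ {n N a b} → N ∣ℤ + 2 * n → N ∣ℤ n * n → a ≡ b mod n → a * a ≡ b * b mod N
square-≡mod {n} {N} {a} {b} N∣2n N∣n² (divides u a-b≡un) =
  subst (N ∣ℤ_) (sym (expand a-b≡un))
    (∣m∣n⇒∣m+n (∣n⇒∣m*n (u * b) N∣2n) (∣n⇒∣m*n (u * u) N∣n²))
  where
  factor : ∀ a b → a * a - b * b ≡ (a - b) * (a - b + + 2 * b)
  factor = solve-∀
  spread : ∀ u n b → u * n * (u * n + + 2 * b) ≡ u * b * (+ 2 * n) + u * u * (n * n)
  spread = solve-∀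
  expand : a - b ≡ u * n → a * a - b * b ≡ u * b * (+ 2 * n) + u * u * (n * n)
  expand e = begin
    a * a - b * b                        ≡⟨ factor a b ⟩
    (a - b) * (a - b + + 2 * b)          ≡⟨ cong (λ d → d * (d + + 2 * b)) e ⟩
    u * n * (u * n + + 2 * b)            ≡⟨ spread u n b ⟩
    u * b * (+ 2 * n) + u * u * (n * n)  ∎
    where open ≡-Reasoning

parallelogram-≡mod : ∀ {n N s t x y} → N ∣ℤ + 2 * n → N ∣ℤ n * n →
  s ≡ x + y mod n → t ≡ x - y mod n → s * s + t * t ≡ + 2 * (x * x) + + 2 * (y * y) mod N
parallelogram-≡mod {s = s} {t} {x} {y} N∣2n N∣n² s≡x+y t≡x-y =
  subst (_ ∣ℤ_) (regroup s t x y)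
    (∣m∣n⇒∣m+n (square-≡mod {a = s} N∣2n N∣n² s≡x+y) (square-≡mod {a = t} N∣2n N∣n² t≡x-y))
  where
  regroup : ∀ s t x y → s * s - (x + y) * (x + y) + (t * t - (x - y) * (x - y))
                        ≡ s * s + t * t - (+ 2 * (x * x) + + 2 * (y * y))
  regroup = solve-∀

missing-values-≡mod : ∀ {n N} T Q a b c d → N ∣ℤ + 2 * n → N ∣ℤ n * n →
  T - c ≡ (T - a) + (T - b) mod n →
  (T - d) + (T - b) ≡ T - a mod n →
  (Q - c * c) + (Q - d * d) ≡ + 2 * (Q - a * a) + + 2 * (Q - b * b) mod N →
  + 2 * Q ≡ + 2 * T * (+ 2 * b - T) mod N
missing-values-≡mod {n} {N} T Q a b c d N∣2n N∣n² sums differences squares =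
  subst (N ∣ℤ_) (combine T Q a b c d)
    (∣m⇒∣-m (∣m∣n⇒∣m+n (∣m∣n⇒∣m+n squares (square-≡mod {a = c} N∣2n N∣n² c≡a+b-T))
                                          (square-≡mod {a = d} N∣2n N∣n² d≡T+a-b)))
  where
  negate₁ : ∀ T a b c → - (T - c - ((T - a) + (T - b))) ≡ c - (a + b - T)
  negate₁ = solve-∀
  c≡a+b-T : c ≡ a + b - T mod n
  c≡a+b-T = subst (n ∣ℤ_) (negate₁ T a b c) (∣m⇒∣-m sums)
  negate₂ : ∀ T a b d → - ((T - d) + (T - b) - (T - a)) ≡ d - (T + a - b)
  negate₂ = solve-∀
  d≡T+a-b : d ≡ T + a - b mod n
  d≡T+a-b = subst (n ∣ℤ_) (negate₂ T a b d) (∣m⇒∣-m differences)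
  -- the key cancellation is (a + b − T)² + (T + a − b)² = 2a² + 2(b − T)²
  combine : ∀ T Q a b c d →
    - ((Q - c * c) + (Q - d * d) - (+ 2 * (Q - a * a) + + 2 * (Q - b * b))
      + (c * c - (a + b - T) * (a + b - T)) + (d * d - (T + a - b) * (T + a - b)))
    ≡ + 2 * Q - + 2 * T * (+ 2 * b - T)
  combine = solve-∀

module Placement {k} (P : NonAttacking (suc k) k) where
  open NonAttacking P

  n : ℤ
  n = + suc k

  column row diagonal antidiagonal : Fin k → Fin (suc k)
  column = proj₁ ∘ queen
  row = proj₂ ∘ queen
  diagonal i = fromℕ< (m%n<n (toℕ (column i) ℕ.+ toℕ (row i)) (suc k))
  antidiagonal i = fromℕ< (m%n<n (toℕ (column i) ℕ.+ (suc k ∸ toℕ (row i))) (suc k))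

  conflict⇒≡ : ∀ {i j} → Conflict (suc k) (queen i) (queen j) → i ≡ j
  conflict⇒≡ {i} {j} conflict with i ≟ j
  ... | yes i≡j = i≡j
  ... | no  i≢j = ⊥-elim (noConf i j i≢j conflict)

  column-injective : Injective _≡_ _≡_ column
  column-injective eq = conflict⇒≡ (inj₁ eq)

  row-injective : Injective _≡_ _≡_ row
  row-injective eq = conflict⇒≡ (inj₂ (inj₁ eq))

  diagonal-injective : Injective _≡_ _≡_ diagonal
  diagonal-injective eq = conflict⇒≡ (inj₂ (inj₂ (inj₁ (fromℕ<-injective _ _ _ _ eq))))

  antidiagonal-injective : Injective _≡_ _≡_ antidiagonal
  antidiagonal-injective eq = conflict⇒≡ (inj₂ (inj₂ (inj₂ (fromℕ<-injective _ _ _ _ eq))))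

  diagonal-≡mod : ∀ i → toℤ (diagonal i) ≡ toℤ (column i) + toℤ (row i) mod n
  diagonal-≡mod i = subst (λ r → + r ≡ toℤ (column i) + toℤ (row i) mod n) (sym (toℕ-fromℕ< _))
    (%-≡mod (toℕ (column i) ℕ.+ toℕ (row i)) (suc k))

  antidiagonal-≡mod : ∀ i → toℤ (antidiagonal i) ≡ toℤ (column i) - toℤ (row i) mod n
  antidiagonal-≡mod i = subst (n ∣ℤ_) (regroup (toℤ (antidiagonal i)) x y n) (∣m∣n⇒∣m+n t≡x+n-y ∣-refl)
    where
    x y : ℤ
    x = toℤ (column i)
    y = toℤ (row i)
    n-y : + (suc k ∸ toℕ (row i)) ≡ n - y
    n-y = sym (trans (m-n≡m⊖n (suc k) (toℕ (row i))) (⊖-≥ (toℕ≤n (row i))))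
    t≡x+n-y : toℤ (antidiagonal i) ≡ x + (n - y) mod n
    t≡x+n-y = subst₂ (λ r z → + r ≡ x + z mod n) (sym (toℕ-fromℕ< _)) n-y
      (%-≡mod (toℕ (column i) ℕ.+ (suc k ∸ toℕ (row i))) (suc k))
    regroup : ∀ t x y n → t - (x + (n - y)) + n ≡ t - (x - y)
    regroup = solve-∀

  2*squarePyramidal-≡mod : ∃[ b ] ∀ {N} → N ∣ℤ + 2 * n → N ∣ℤ n * n →
    + 2 * squarePyramidal (suc k) ≡ + 2 * triangular (suc k) * (+ 2 * b - triangular (suc k)) mod N
  2*squarePyramidal-≡mod
    with sum∘injection column column-injective | sum∘injection row row-injective
       | sum∘injection diagonal diagonal-injective | sum∘injection antidiagonal antidiagonal-injective
  ... | a , Σcolumn | b , Σrow | c , Σdiagonal | d , Σantidiagonal = toℤ b , λ N∣2n N∣n² →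
    missing-values-≡mod (triangular (suc k)) (squarePyramidal (suc k))
      (toℤ a) (toℤ b) (toℤ c) (toℤ d) N∣2n N∣n²
      (subst₂ (_≡_mod n) (Σdiagonal toℤ) (Σsum (Σcolumn toℤ) (Σrow toℤ))
        (sum-≡mod diagonal-≡mod))
      (subst₂ (_≡_mod n) (Σsum (Σantidiagonal toℤ) (Σrow toℤ)) (Σcolumn toℤ)
        (sum-≡mod λ i → subst (n ∣ℤ_) (regroup (toℤ (antidiagonal i)) (toℤ (column i)) (toℤ (row i)))
                                       (antidiagonal-≡mod i)))
      (subst₂ (_≡_mod _) (Σsum (Σdiagonal square) (Σantidiagonal square))
                         (Σsum (Σdouble (Σcolumn square)) (Σdouble (Σrow square)))
        (sum-≡mod λ i → parallelogram-≡mod {s = toℤ (diagonal i)} {toℤ (antidiagonal i)}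
                          {toℤ (column i)} {toℤ (row i)} N∣2n N∣n² (diagonal-≡mod i) (antidiagonal-≡mod i)))
    where
    regroup : ∀ t x y → t - (x - y) ≡ t + y - x
    regroup = solve-∀
    square : Fin (suc k) → ℤ
    square r = toℤ r * toℤ r
    Σsum : ∀ {f g : Fin k → ℤ} {u v} → sum f ≡ u → sum g ≡ v → sum (λ i → f i + g i) ≡ u + v
    Σsum {f} {g} f≡u g≡v = trans (∑-distrib-+ f g) (cong₂ _+_ f≡u g≡v)
    Σdouble : ∀ {f : Fin k → ℤ} {u} → sum f ≡ u → sum (λ i → + 2 * f i) ≡ + 2 * u
    Σdouble {f} f≡u = trans (sym (*-distribˡ-sum (+ 2) f)) (cong (+ 2 *_) f≡u)

  n∣2*squarePyramidal : n ∣ℤ + 2 * squarePyramidal (suc k)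
  n∣2*squarePyramidal =
    ∣-resp-≡mod (proj₂ 2*squarePyramidal-≡mod {n} (∣n⇒∣m*n (+ 2) ∣-refl) (∣m⇒∣m*n n ∣-refl)) n∣2T[2b-T]
    where
    b : ℤ
    b = proj₁ 2*squarePyramidal-≡mod
    T : ℤ
    T = triangular (suc k)
    n∣2T[2b-T] : n ∣ℤ + 2 * T * (+ 2 * b - T)
    n∣2T[2b-T] = subst (λ z → n ∣ℤ z * (+ 2 * b - T)) (sym (2*triangular (suc k)))
      (∣m⇒∣m*n (+ 2 * b - T) (∣m⇒∣m*n (n - + 1) (∣-refl {n})))

  -- When 4 ∣ n the triangular number T = n(n − 1)/2 is even, hence so is 2b − T.
  4∣n⇒2n∣2*squarePyramidal : + 4 ∣ℤ n → + 2 * n ∣ℤ + 2 * squarePyramidal (suc k)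
  4∣n⇒2n∣2*squarePyramidal (divides m n≡m*4) =
    ∣-resp-≡mod (proj₂ 2*squarePyramidal-≡mod {+ 2 * n} ∣-refl (divides (+ 2 * m) n*n≡2m*2n))
    (divides ((n - + 1) * (b - m * (n - + 1))) (begin
      + 2 * T * (+ 2 * b - T)                          ≡⟨ cong₂ (λ u v → u * (+ 2 * b - v)) 2T≡n[n-1] T≡2m[n-1] ⟩
      n * (n - + 1) * (+ 2 * b - + 2 * m * (n - + 1))  ≡⟨ factor n m b ⟩
      (n - + 1) * (b - m * (n - + 1)) * (+ 2 * n)      ∎))
    where
    open ≡-Reasoning
    b T : ℤ
    b = proj₁ 2*squarePyramidal-≡mod
    T = triangular (suc k)
    halve : ∀ m x → m * + 4 * x ≡ + 2 * (+ 2 * m * x)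
    halve = solve-∀
    swap : ∀ n m → n * (m * + 4) ≡ + 2 * m * (+ 2 * n)
    swap = solve-∀
    factor : ∀ n m b → n * (n - + 1) * (+ 2 * b - + 2 * m * (n - + 1))
                       ≡ (n - + 1) * (b - m * (n - + 1)) * (+ 2 * n)
    factor = solve-∀
    2T≡n[n-1] : + 2 * T ≡ n * (n - + 1)
    2T≡n[n-1] = 2*triangular (suc k)
    T≡2m[n-1] : T ≡ + 2 * m * (n - + 1)
    T≡2m[n-1] = *-cancelˡ-≡ (+ 2) T _
      (trans 2T≡n[n-1] (trans (cong (_* (n - + 1)) n≡m*4) (halve m (n - + 1))))
    n*n≡2m*2n : n * n ≡ + 2 * m * (+ 2 * n)
    n*n≡2m*2n = trans (cong (n *_) n≡m*4) (swap n m)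

theorem2 : (k : ℕ) → (3 ∣ suc k ⊎ 4 ∣ suc k) → ¬ NonAttacking (suc k) (suc k ∸ 1)
theorem2 k (inj₁ 3∣n) P = contradiction (+∣1⇒≡1 3∣1) λ ()
  where
  open Placement P
  3∣[n-1][2n-1] : + 3 ∣ℤ (n - + 1) * (+ 2 * n - + 1)
  3∣[n-1][2n-1] = ∣2*squarePyramidal⇒∣[m-1][2m-1] (suc k) (+ 1)
    (subst (_∣ℤ + 2 * squarePyramidal (suc k)) (sym (*-identityʳ n)) n∣2*squarePyramidal)
  3∣1 : + 3 ∣ℤ + 1
  3∣1 = ∣m∧∣[m-1][2m-1]⇒∣1 (∣ᵤ⇒∣ {i = n} 3∣n) 3∣[n-1][2n-1]
theorem2 k (inj₂ 4∣n) P = contradiction (+∣1⇒≡1 2∣1) λ ()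
  where
  open Placement P
  6∣[n-1][2n-1] : + 6 ∣ℤ (n - + 1) * (+ 2 * n - + 1)
  6∣[n-1][2n-1] = ∣2*squarePyramidal⇒∣[m-1][2m-1] (suc k) (+ 2)
    (subst (_∣ℤ + 2 * squarePyramidal (suc k)) (*-comm (+ 2) n) (4∣n⇒2n∣2*squarePyramidal (∣ᵤ⇒∣ {i = n} 4∣n)))
  2∣1 : + 2 ∣ℤ + 1
  2∣1 = ∣m∧∣[m-1][2m-1]⇒∣1 (∣-trans (divides (+ 2) refl) (∣ᵤ⇒∣ {i = n} 4∣n))
                           (∣-trans (divides (+ 3) refl) 6∣[n-1][2n-1])
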